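{- Let $A\subseteq\omega$ be $m$-rigid. Then the bounded finite-one degree $\deg_{bfin}(A)$ contains an infinite strict ascending chain of $1$-degrees: there are sets $B_0,B_1,B_2,\dots$, each with $B_n\equiv_{bfin}A$, such that $B_n<_1 B_{n+1}$ for all $n$. In particular $\deg_{bfin}(A)$ is not a single $1$-degree.
   Context: A set $A\subseteq\omega$ is $m$-rigid if for every total computable $f$ with $x\in A\iff f(x)\in A$ for all $x$, $f(x)=x$ for all but finitely many $x$. $A\le_1 B$: via an injective total computable $f$ with $x\in A\iff f(x)\in B$. $A\le_{bfin}B$: via a total computable $f$ with $x\in A\iff f(x)\in B$ and a constant $c\ge1$ with $|f^{ -1}(y)|\le c$ for all $y$. $\equiv_r$ denotes mutual $\le_r$-reducibility, $\deg_{bfin}(A)=\{B:B\equiv_{bfin}A\}$, and $A<_1B$ means $A\le_1B$ and $B\not\le_1A$. -}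

module Defs where

open import Data.Nat using (ℕ; zero; suc; _≤_; _<_)
open import Data.Fin using (Fin)
open import Data.Vec using (Vec; []; _∷_; lookup; map)
open import Data.List using (List; length)
open import Data.List.Relation.Unary.All using (All)
open import Data.List.Relation.Unary.Unique.Propositional using (Unique)
open import Data.Product using (Σ; ∃; _×_; _,_)
open import Relation.Binary.PropositionalEquality using (_≡_)
open import Relation.Nullary using (¬_)
open import Function.Definitions using (Injective)

data Code : ℕ → Set where
  zer  : ∀ {n} → Code n
  succ : Code 1
  proj : ∀ {n} → Fin n → Code n
  comp : ∀ {n m} → Code m → Vec (Code n) m → Code n
  prec : ∀ {n} → Code n → Code (suc (suc n)) → Code (suc n)
  mu   : ∀ {n} → Code (suc n) → Code n

mutual
  data Eval : ∀ {n} → Code n → Vec ℕ n → ℕ → Set where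
    ev-zer  : ∀ {n} {xs : Vec ℕ n} → Eval zer xs 0
    ev-succ : ∀ {x} → Eval succ (x ∷ []) (suc x)
    ev-proj : ∀ {n} {i : Fin n} {xs} → Eval (proj i) xs (lookup xs i)
    ev-comp : ∀ {n m} {g : Code m} {hs : Vec (Code n) m} {xs ys y} →
              EvalAll hs xs ys → Eval g ys y → Eval (comp g hs) xs y
    ev-prec-z : ∀ {n} {g : Code n} {h : Code (suc (suc n))} {xs y} →
              Eval g xs y → Eval (prec g h) (0 ∷ xs) y
    ev-prec-s : ∀ {n} {g : Code n} {h : Code (suc (suc n))} {k xs r y} →
              Eval (prec g h) (k ∷ xs) r → Eval h (k ∷ r ∷ xs) y →
              Eval (prec g h) (suc k ∷ xs) y
    ev-mu   : ∀ {n} {f : Code (suc n)} {xs y} →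
              Eval f (y ∷ xs) 0 →
              (∀ z → z < y → ∃ λ k → Eval f (z ∷ xs) (suc k)) →
              Eval (mu f) xs y

  data EvalAll {n} : ∀ {m} → Vec (Code n) m → Vec ℕ n → Vec ℕ m → Set where
    ev-[] : ∀ {xs} → EvalAll [] xs []
    ev-∷  : ∀ {m} {h : Code n} {hs : Vec (Code n) m} {xs y ys} →
            Eval h xs y → EvalAll hs xs ys → EvalAll (h ∷ hs) xs (y ∷ ys)

Computable : (ℕ → ℕ) → Set
Computable f = Σ (Code 1) λ e → ∀ x → Eval e (x ∷ []) (f x)

SetN : Set₁
SetN = ℕ → Set

_⇔_ : Set → Set → Set
P ⇔ Q = (P → Q) × (Q → P)

Reduces : (ℕ → ℕ) → SetN → SetN → Set
Reduces f A B = ∀ x → A x ⇔ B (f x)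

MRigid : SetN → Set
MRigid A = ∀ (f : ℕ → ℕ) → Computable f → Reduces f A A →
           ∃ λ N → ∀ x → N ≤ x → f x ≡ x

_≤₁_ : SetN → SetN → Set
A ≤₁ B = Σ (ℕ → ℕ) λ f → Computable f × Injective _≡_ _≡_ f × Reduces f A B

-- |f⁻¹(y)| ≤ c : every duplicate-free list of preimages of y has length ≤ c
FiberBound : (ℕ → ℕ) → ℕ → Set
FiberBound f c = ∀ y (xs : List ℕ) → Unique xs → All (λ x → f x ≡ y) xs → length xs ≤ c

_≤bfin_ : SetN → SetN → Set
A ≤bfin B = Σ (ℕ → ℕ) λ f → Computable f × Reduces f A B ×
            (∃ λ c → 1 ≤ c × FiberBound f c)

_≡bfin_ : SetN → SetN → Set
A ≡bfin B = (A ≤bfin B) × (B ≤bfin A)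

_<₁_ : SetN → SetN → Set
A <₁ B = (A ≤₁ B) × ¬ (B ≤₁ A)

-- Let B n x = A (x ∸ n). Then x ↦ x ∸ n and x ↦ n + x are bounded finite-one
-- reductions between B n and A, and suc is a 1-reduction of B n to B (n + 1).
-- Conversely, a 1-reduction g of B (n + 1) to B n makes x ↦ g (n + 1 + x) ∸ n a
-- computable self m-reduction of A. By rigidity it is cofinitely the identity,
-- so g is cofinitely the predecessor; but then the injection g would map
-- {0, …, Q} into {0, …, Q - 1} for some Q.
module Submission where

open import Defs
open import Data.Nat using (ℕ; zero; suc; pred; _+_; _∸_; _≤_; _<_; z≤n; s≤s; _≤?_)
open import Data.Nat.Properties
open import Data.Fin using (Fin; toℕ; fromℕ<) renaming (zero to fzero; suc to fsuc)
open import Data.Fin.Properties using (toℕ-injective; toℕ≤pred[n]; fromℕ<-injective; injective⇒≤; <⇒notInjective)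
open import Data.Vec using ([]; _∷_)
open import Data.List using (List; []; _∷_; length; lookup)
open import Data.List.Membership.Propositional.Properties using (∈-lookup)
open import Data.List.Relation.Unary.All as All using (All; _∷_)
open import Data.List.Relation.Unary.AllPairs using (_∷_)
open import Data.List.Relation.Unary.Unique.Propositional using (Unique)
open import Data.Product using (Σ; _×_; _,_; proj₁; proj₂)
open import Function.Definitions using (Injective)
open import Relation.Binary.PropositionalEquality
open import Relation.Nullary using (¬_; yes; no; contradiction)

computable-∘ : ∀ {f g} → Computable f → Computable g → Computable (λ x → f (g x))
computable-∘ {g = g} (ef , f-eval) (eg , g-eval) =
  comp ef (eg ∷ []) , λ x → ev-comp (ev-∷ (g-eval x) ev-[]) (f-eval (g x))

computable-cong : ∀ {f g} → (∀ x → f x ≡ g x) → Computable f → Computable g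
computable-cong f≗g (e , f-eval) = e , λ x → subst (Eval e (x ∷ [])) (f≗g x) (f-eval x)

computable-id : Computable (λ x → x)
computable-id = proj fzero , λ _ → ev-proj

computable-suc : Computable suc
computable-suc = succ , λ _ → ev-succ

computable-pred : Computable pred
computable-pred = prec zer (proj fzero) , eval
  where
  eval : ∀ x → Eval (prec zer (proj fzero)) (x ∷ []) (pred x)
  eval zero    = ev-prec-z ev-zer
  eval (suc x) = ev-prec-s (eval x) ev-proj

computable-+ : ∀ k → Computable (k +_)
computable-+ zero    = computable-id
computable-+ (suc k) = computable-∘ computable-suc (computable-+ k)

computable-∸ : ∀ k → Computable (_∸ k)
computable-∸ zero    = computable-id
computable-∸ (suc k) =
  computable-cong (λ x → pred[m∸n]≡m∸[1+n] x k) (computable-∘ computable-pred (computable-∸ k))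

Unique-lookup-injective : ∀ {xs : List ℕ} → Unique xs → Injective _≡_ _≡_ (lookup xs)
Unique-lookup-injective {_ ∷ _} _ {fzero} {fzero} _ = refl
Unique-lookup-injective (x∉xs ∷ _) {fzero} {fsuc j} eq =
  contradiction eq (All.lookup x∉xs (∈-lookup j))
Unique-lookup-injective (x∉xs ∷ _) {fsuc i} {fzero} eq =
  contradiction (sym eq) (All.lookup x∉xs (∈-lookup i))
Unique-lookup-injective (_ ∷ uniq) {fsuc i} {fsuc j} eq =
  cong fsuc (Unique-lookup-injective uniq eq)

Unique∧All<⇒length≤ : ∀ {K xs} → Unique xs → All (_< K) xs → length xs ≤ K
Unique∧All<⇒length≤ {K} {xs} uniq xs<K = injective⇒≤ index-injective
  where
  index : Fin (length xs) → Fin K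
  index i = fromℕ< (All.lookup xs<K (∈-lookup i))

  index-injective : Injective _≡_ _≡_ index
  index-injective eq = Unique-lookup-injective uniq (fromℕ<-injective _ _ _ _ eq)

Unique∧All-subsingleton⇒length≤1 : ∀ {P : ℕ → Set} {xs} → (∀ {a b} → P a → P b → a ≡ b) →
                                   Unique xs → All P xs → length xs ≤ 1
Unique∧All-subsingleton⇒length≤1 {xs = []}        _     _                _             = z≤n
Unique∧All-subsingleton⇒length≤1 {xs = _ ∷ []}    _     _                _             = s≤s z≤n
Unique∧All-subsingleton⇒length≤1 {xs = _ ∷ _ ∷ _} P-sub ((x≢y ∷ _) ∷ _) (Px ∷ Py ∷ _) =
  contradiction (P-sub Px Py) x≢y

injective⇒FiberBound1 : ∀ {f} → Injective _≡_ _≡_ f → FiberBound f 1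
injective⇒FiberBound1 f-inj y _ =
  Unique∧All-subsingleton⇒length≤1 (λ fa≡y fb≡y → f-inj (trans fa≡y (sym fb≡y)))

m∸n≡1+o⇒m≡n+1+o : ∀ {m} n {o} → m ∸ n ≡ suc o → m ≡ n + suc o
m∸n≡1+o⇒m≡n+1+o {m} n eq = begin
  m               ≡⟨ m+[n∸m]≡n n≤m ⟨
  n + (m ∸ n)     ≡⟨ cong (n +_) eq ⟩
  n + suc _       ∎
  where
  open ≡-Reasoning
  n≤m : n ≤ m
  n≤m = <⇒≤ (m∸n≢0⇒n<m (λ m∸n≡0 → 0≢1+n (trans (sym m∸n≡0) eq)))

∸-FiberBound : ∀ n → FiberBound (_∸ n) (suc n)
∸-FiberBound n zero    _ uniq in-fiber =
  Unique∧All<⇒length≤ uniq (All.map (λ x∸n≡0 → s≤s (m∸n≡0⇒m≤n x∸n≡0)) in-fiber)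
∸-FiberBound n (suc y) _ uniq in-fiber =
  ≤-trans (Unique∧All-subsingleton⇒length≤1 fiber-subsingleton uniq in-fiber) (s≤s z≤n)
  where
  fiber-subsingleton : ∀ {a b} → a ∸ n ≡ suc y → b ∸ n ≡ suc y → a ≡ b
  fiber-subsingleton a∸n≡1+y b∸n≡1+y =
    trans (m∸n≡1+o⇒m≡n+1+o n a∸n≡1+y) (sym (m∸n≡1+o⇒m≡n+1+o n b∸n≡1+y))

injective⇒¬cofinitely-pred : ∀ {g : ℕ → ℕ} Q → Injective _≡_ _≡_ g →
                             ¬ (∀ x → g (suc (Q + x)) ≡ Q + x)
injective⇒¬cofinitely-pred {g} Q g-inj g-pred = <⇒notInjective (n<1+n Q) restrict-injective
  where
  -- A value g i ≥ Q is also taken at suc (g i) ≠ i.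
  g-below : ∀ i → i ≤ Q → g i < Q
  g-below i i≤Q with Q ≤? g i
  ... | no  Q≰gi = ≰⇒> Q≰gi
  ... | yes Q≤gi = contradiction (g-inj g-pred′) (>⇒≢ (s≤s (≤-trans i≤Q Q≤gi)))
    where
    g-pred′ : g (suc (g i)) ≡ g i
    g-pred′ = subst (λ y → g (suc y) ≡ y) (m+[n∸m]≡n Q≤gi) (g-pred (g i ∸ Q))

  restrict : Fin (suc Q) → Fin Q
  restrict i = fromℕ< (g-below (toℕ i) (toℕ≤pred[n] i))

  restrict-injective : Injective _≡_ _≡_ restrict
  restrict-injective eq = toℕ-injective (g-inj (fromℕ<-injective _ _ _ _ eq))

shift : SetN → ℕ → SetN
shift A n x = A (x ∸ n)

shift≡bfin : ∀ A n → shift A n ≡bfin A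
shift≡bfin A n =
  ((_∸ n) , computable-∸ n , (λ _ → (λ p → p) , (λ p → p)) , suc n , s≤s z≤n , ∸-FiberBound n) ,
  ((n +_) , computable-+ n , A≤shift , 1 , s≤s z≤n , injective⇒FiberBound1 (+-cancelˡ-≡ n _ _))
  where
  A≤shift : Reduces (n +_) A (shift A n)
  A≤shift x = subst A (sym (m+n∸m≡n n x)) , subst A (m+n∸m≡n n x)

shift≤₁shift-suc : ∀ A n → shift A n ≤₁ shift A (suc n)
shift≤₁shift-suc A n = suc , computable-suc , suc-injective , λ _ → (λ p → p) , (λ p → p)

shift-suc≰₁shift : ∀ A → MRigid A → ∀ n → ¬ (shift A (suc n) ≤₁ shift A n)
shift-suc≰₁shift A rigid n (g , g-computable , g-inj , g-reduces) =
  injective⇒¬cofinitely-pred (n + suc N) g-inj g-pred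
  where
  f : ℕ → ℕ
  f x = g (suc n + x) ∸ n

  f-computable : Computable f
  f-computable = computable-∘ (computable-∸ n) (computable-∘ g-computable (computable-+ (suc n)))

  f-reduces : Reduces f A A
  f-reduces x with g-reduces (suc n + x)
  ... | to , from = (λ p → to (subst A (sym (m+n∸m≡n (suc n) x)) p)) ,
                    (λ p → subst A (m+n∸m≡n (suc n) x) (from p))

  N : ℕ
  N = proj₁ (rigid f f-computable f-reduces)

  f-id : ∀ x → N ≤ x → f x ≡ x
  f-id = proj₂ (rigid f f-computable f-reduces)

  g-pred : ∀ x → g (suc (n + suc N + x)) ≡ n + suc N + x
  g-pred x = subst (λ y → g (suc y) ≡ y) (sym (+-assoc n (suc N) x))
                   (m∸n≡1+o⇒m≡n+1+o n (f-id (suc (N + x)) (≤-trans (m≤m+n N x) (n≤1+n _))))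

corollary4p4 : (A : SetN) → MRigid A →
    Σ (ℕ → SetN) λ B → ((n : ℕ) → B n ≡bfin A) × ((n : ℕ) → B n <₁ B (suc n))
corollary4p4 A rigid =
  shift A , shift≡bfin A , λ n → shift≤₁shift-suc A n , shift-suc≰₁shift A rigid n
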